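{- If a DAG $G$ with $L(G)=X$ has the global lca-property, then $G$ is a network and $\mathfrak{C}_G$ is a closed clustering system on $X$.
   Context: A DAG is a finite directed graph without loops and directed cycles; $u\preceq_G v$ means there is a directed path from $v$ to $u$ (including $u=v$). $L(G)$ is the set of $\preceq_G$-minimal vertices. A network is a DAG with exactly one $\preceq_G$-maximal vertex. For non-empty $A\subseteq V(G)$, $\mathrm{LCA}_G(A)$ is the set of $\preceq_G$-minimal vertices $v$ with $a\preceq_G v$ for all $a\in A$; $G$ has the global lca-property if $|\mathrm{LCA}_G(A)|=1$ for all non-empty $A\subseteq V(G)$. $C_G(v)=\{x\in L(G):x\preceq_G v\}$, $\mathfrak{C}_G=\{C_G(v):v\in V(G)\}$. A set system on $X$ is a clustering system if it contains $X$ and $\{x\}$ for all $x\in X$ and not $\emptyset$; it is closed if $A,B\in\mathfrak{C}$ implies $A\cap B\in\mathfrak{C}$ or $A\cap B=\emptyset$. -}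

module Defs where

open import Level using (0ℓ)
open import Data.Nat using (ℕ)
open import Data.Fin using (Fin)
open import Data.Fin.Subset using (Subset; _∈_)
open import Data.Product using (Σ; ∃; _×_; _,_)
open import Data.Sum using (_⊎_)
open import Data.Empty using (⊥)
open import Relation.Nullary using (¬_)
open import Relation.Binary using (Rel; Decidable)
open import Relation.Binary.PropositionalEquality using (_≡_)
open import Relation.Binary.Construct.Closure.ReflexiveTransitive using (Star)

module _ {n : ℕ} (E : Rel (Fin n) 0ℓ) where

  IsDAG : Set
  IsDAG = (∀ v → ¬ E v v) × (∀ u v → E u v → Star E v u → ⊥)

  _⪯_ : Fin n → Fin n → Set
  u ⪯ v = Star E v u

  IsLeaf : Fin n → Set
  IsLeaf v = ∀ u → u ⪯ v → u ≡ v

  IsMaximal : Fin n → Set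
  IsMaximal v = ∀ u → v ⪯ u → u ≡ v

  IsNetwork : Set
  IsNetwork = Σ (Fin n) λ r → IsMaximal r × (∀ w → IsMaximal w → w ≡ r)

  IsUpperBound : Subset n → Fin n → Set
  IsUpperBound A v = ∀ a → a ∈ A → a ⪯ v

  InLCA : Subset n → Fin n → Set
  InLCA A v = IsUpperBound A v × (∀ w → IsUpperBound A w → w ⪯ v → w ≡ v)

  GlobalLCA : Set
  GlobalLCA = ∀ (A : Subset n) → (Σ (Fin n) λ a → a ∈ A) →
              Σ (Fin n) λ v → ∀ w → (InLCA A w → w ≡ v) × (w ≡ v → InLCA A w)

  InCluster : Fin n → Fin n → Set
  InCluster v x = IsLeaf x × (x ⪯ v)

  -- 𝔆_G = {C_G(v)} is a clustering system on X = L(G):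
  -- X ∈ 𝔆, {x} ∈ 𝔆 for every x ∈ X, ∅ ∉ 𝔆  (sets compared extensionally)
  IsClusteringSystem : Set
  IsClusteringSystem =
    (Σ (Fin n) λ v → ∀ x → (InCluster v x → IsLeaf x) × (IsLeaf x → InCluster v x))
    × (∀ x → IsLeaf x → Σ (Fin n) λ v → ∀ y → (InCluster v y → y ≡ x) × (y ≡ x → InCluster v y))
    × (∀ v → Σ (Fin n) λ x → InCluster v x)

  -- closed: C(u) ∩ C(v) ∈ 𝔆 or C(u) ∩ C(v) = ∅
  IsClosed : Set
  IsClosed = ∀ u v →
    (Σ (Fin n) λ w → ∀ x → (InCluster w x → InCluster u x × InCluster v x)
                          × (InCluster u x × InCluster v x → InCluster w x))
    ⊎ (∀ x → ¬ (InCluster u x × InCluster v x))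

{-# OPTIONS --safe #-}
-- Acyclicity makes proper descent a strict partial order on the finite vertex set, hence
-- well founded: reachability becomes decidable, and below every witness of a decidable
-- property lies a minimal one. So every vertex is above a leaf, and every upper bound z of A
-- is above the lca of A, because a minimal upper bound below z lies in LCA(A). The lca of all
-- vertices is the root, and if u and v have a common descendant, the lca of their common
-- descendants is their meet w, whence C(u) ∩ C(v) = C(w).
module Submission where

open import Defs
open import Level using (0ℓ)
open import Data.Nat using (ℕ; suc)
open import Data.Fin using (Fin; zero)
open import Data.Fin.Induction using (spo-wellFounded)
open import Data.Fin.Properties using (any?; all?; _≟_)
open import Data.Fin.Subset using (Subset; _∈_)
import Data.Fin.Subset as Subset
open import Data.Fin.Subset.Properties using (_∈?_; ∈⊤)
open import Data.Vec using (tabulate)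
open import Data.Vec.Properties using (lookup∘tabulate; lookup⇒[]=; []=⇒lookup)
open import Data.Unit using (⊤; tt)
open import Data.Product using (∃; _×_; _,_; proj₁; proj₂)
open import Data.Sum using (_⊎_; inj₁; inj₂; [_,_])
open import Function using (_∘_; id)
open import Induction.WellFounded using (WellFounded; Acc; acc)
open import Relation.Nullary using (¬_; Dec; yes; no; does; contradiction)
open import Relation.Nullary.Decidable using (map′; dec-true; _×-dec_; _⊎-dec_; _→-dec_)
open import Relation.Binary using (Rel; Decidable; IsStrictPartialOrder)
open import Relation.Binary.PropositionalEquality using (_≡_; refl; sym; trans; subst; isEquivalence; resp₂)
open import Relation.Binary.Construct.Closure.ReflexiveTransitive using (Star; ε; _◅_; _◅◅_)

module _ {n : ℕ} {P : Fin n → Set} (P? : ∀ x → Dec (P x)) where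

  subsetOf : Subset n
  subsetOf = tabulate (does ∘ P?)

  ∈-subsetOf⁺ : ∀ {x} → P x → x ∈ subsetOf
  ∈-subsetOf⁺ {x} px = lookup⇒[]= x subsetOf (trans (lookup∘tabulate _ x) (dec-true (P? x) px))

  ∈-subsetOf⁻ : ∀ {x} → x ∈ subsetOf → P x
  ∈-subsetOf⁻ {x} x∈ with P? x | trans (sym (lookup∘tabulate (does ∘ P?) x)) ([]=⇒lookup x∈)
  ... | yes px | _ = px
  ... | no _   | ()

module DAG {n : ℕ} {E : Rel (Fin n) 0ℓ} (E? : Decidable E) (dag : IsDAG E) where

  acyclic : ∀ {u v} → E u v → ¬ Star E v u
  acyclic = proj₂ dag _ _

  infix 4 _⊏_

  _⊏_ : Rel (Fin n) 0ℓ
  u ⊏ v = ∃ λ w → E v w × Star E w u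

  ⊏-step : ∀ {u v} → E v u → u ⊏ v
  ⊏-step e = _ , e , ε

  ⊏⇒Star : ∀ {u v} → u ⊏ v → Star E v u
  ⊏⇒Star (_ , e , p) = e ◅ p

  Star⇒≡⊎⊏ : ∀ {u v} → Star E v u → u ≡ v ⊎ u ⊏ v
  Star⇒≡⊎⊏ ε       = inj₁ refl
  Star⇒≡⊎⊏ (e ◅ p) = inj₂ (_ , e , p)

  ≡⊎⊏⇒Star : ∀ {u v} → u ≡ v ⊎ u ⊏ v → Star E v u
  ≡⊎⊏⇒Star (inj₁ refl) = ε
  ≡⊎⊏⇒Star (inj₂ u⊏v)  = ⊏⇒Star u⊏v

  Star-antisym : ∀ {u v} → Star E u v → Star E v u → u ≡ v
  Star-antisym ε       _ = refl
  Star-antisym (e ◅ p) q = contradiction (p ◅◅ q) (acyclic e)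

  ⊏-isStrictPartialOrder : IsStrictPartialOrder _≡_ _⊏_
  ⊏-isStrictPartialOrder = record
    { isEquivalence = isEquivalence
    ; irrefl        = λ { refl (_ , e , p) → acyclic e p }
    ; trans         = λ { u⊏v (_ , e , p) → _ , e , p ◅◅ ⊏⇒Star u⊏v }
    ; <-resp-≈      = resp₂ _⊏_
    }

  ⊏-wellFounded : WellFounded _⊏_
  ⊏-wellFounded = spo-wellFounded ⊏-isStrictPartialOrder

  ⊏?⇒Star? : ∀ {u v} → Dec (u ⊏ v) → Dec (Star E v u)
  ⊏?⇒Star? {u} {v} u⊏v? = map′ ≡⊎⊏⇒Star Star⇒≡⊎⊏ (u ≟ v ⊎-dec u⊏v?)

  ⊏?-acc : ∀ {v} → Acc _⊏_ v → ∀ u → Dec (u ⊏ v)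
  ⊏?-acc {v} (acc rs) u = any? edge-then-path?
    where
    edge-then-path? : ∀ w → Dec (E v w × Star E w u)
    edge-then-path? w with E? v w
    ... | no ¬e = no (¬e ∘ proj₁)
    ... | yes e = map′ (e ,_) proj₂ (⊏?⇒Star? (⊏?-acc (rs (⊏-step e)) u))

  _⊏?_ : Decidable _⊏_
  u ⊏? v = ⊏?-acc (⊏-wellFounded v) u

  Star? : Decidable (Star E)
  Star? v u = ⊏?⇒Star? (u ⊏? v)

  commonDescendant? : ∀ u v x → Dec (Star E u x × Star E v x)
  commonDescendant? u v x = Star? u x ×-dec Star? v x

  IsMinimal : (Fin n → Set) → Fin n → Set
  IsMinimal P w = ∀ u → P u → Star E w u → u ≡ w

  minimal-below : ∀ {P : Fin n → Set} → (∀ v → Dec (P v)) →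
                  ∀ {v} → P v → ∃ λ w → Star E v w × P w × IsMinimal P w
  minimal-below {P} P? {v} = go (⊏-wellFounded v)
    where
    go : ∀ {v} → Acc _⊏_ v → P v → ∃ λ w → Star E v w × P w × IsMinimal P w
    go {v} (acc rs) pv with any? (λ u → P? u ×-dec u ⊏? v)
    ... | yes (u , pu , u⊏v) =
      let w , u→w , pw , minimal = go (rs u⊏v) pu in w , ⊏⇒Star u⊏v ◅◅ u→w , pw , minimal
    ... | no ∄u = v , ε , pv , λ u pu v→u →
      [ id , (λ u⊏v → contradiction (u , pu , u⊏v) ∄u) ] (Star⇒≡⊎⊏ v→u)

  leaf-below : ∀ v → ∃ λ x → InCluster E v x
  leaf-below v with minimal-below {P = λ _ → ⊤} (λ _ → yes tt) tt
  ... | x , v→x , _ , minimal = x , (λ u x→u → minimal u tt x→u) , v→x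

  IsUpperBound? : ∀ A v → Dec (IsUpperBound E A v)
  IsUpperBound? A v = all? (λ a → a ∈? A →-dec Star? v a)

  reachesAll⇒network : ∀ r → (∀ v → Star E r v) → IsNetwork E
  reachesAll⇒network r r→ =
    r , (λ u u→r → Star-antisym u→r (r→ u)) , (λ w maximal → sym (maximal r (r→ w)))

  reachesAll⇒clusteringSystem : ∀ r → (∀ v → Star E r v) → IsClusteringSystem E
  reachesAll⇒clusteringSystem r r→ =
      (r , λ x → proj₁ , (_, r→ x))
    , (λ x leaf → x , λ y → (λ (_ , x→y) → leaf y x→y) , λ { refl → leaf , ε })
    , leaf-below

  module _ (glca : GlobalLCA E) where

    lca : (A : Subset n) → (∃ λ a → a ∈ A) → Fin n
    lca A ne = proj₁ (glca A ne)

    lca-upperBound : ∀ A ne → IsUpperBound E A (lca A ne)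
    lca-upperBound A ne = proj₁ (proj₂ (proj₂ (glca A ne) (lca A ne)) refl)

    lca-unique : ∀ A ne {w} → InLCA E A w → w ≡ lca A ne
    lca-unique A ne {w} = proj₁ (proj₂ (glca A ne) w)

    lca-least : ∀ A ne {z} → IsUpperBound E A z → Star E z (lca A ne)
    lca-least A ne z-ub with minimal-below (IsUpperBound? A) z-ub
    ... | w , z→w , w-ub , minimal = subst (Star E _) (lca-unique A ne (w-ub , minimal)) z→w

    meet : ∀ {u v y} → Star E u y → Star E v y →
           ∃ λ w → Star E u w × Star E v w × (∀ {x} → Star E u x → Star E v x → Star E w x)
    meet {u} {v} {y} u→y v→y =
        lca D D-nonempty
      , lca-least D D-nonempty (λ _ x∈D → proj₁ (∈-subsetOf⁻ common? x∈D))
      , lca-least D D-nonempty (λ _ x∈D → proj₂ (∈-subsetOf⁻ common? x∈D))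
      , λ {x} u→x v→x → lca-upperBound D D-nonempty x (∈-subsetOf⁺ common? (u→x , v→x))
      where
      common? : ∀ x → Dec (Star E u x × Star E v x)
      common? = commonDescendant? u v
      D : Subset n
      D = subsetOf common?
      D-nonempty : ∃ λ x → x ∈ D
      D-nonempty = y , ∈-subsetOf⁺ common? (u→y , v→y)

    closed : IsClosed E
    closed u v with any? (commonDescendant? u v)
    ... | no ∄y = inj₂ λ x ((_ , u→x) , (_ , v→x)) → ∄y (x , u→x , v→x)
    ... | yes (y , u→y , v→y) with meet u→y v→y
    ... | w , u→w , v→w , greatest = inj₁ (w , λ x →
            (λ (leaf , w→x) → (leaf , u→w ◅◅ w→x) , (leaf , v→w ◅◅ w→x))
          , (λ ((leaf , u→x) , (_ , v→x)) → leaf , greatest u→x v→x))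

lemma3p3 : (n : ℕ) (E : Rel (Fin (suc n)) 0ℓ) → Decidable E →
    IsDAG E → GlobalLCA E → IsNetwork E × IsClusteringSystem E × IsClosed E
lemma3p3 n E E? dag glca =
  reachesAll⇒network root root→ , reachesAll⇒clusteringSystem root root→ , closed glca
  where
  open DAG E? dag
  everything : ∃ λ v → v ∈ Subset.⊤
  everything = zero , ∈⊤
  root : Fin (suc n)
  root = lca glca Subset.⊤ everything
  root→ : ∀ v → Star E root v
  root→ v = lca-upperBound glca Subset.⊤ everything v ∈⊤
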